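{- Let $n\ge5$ and let $A$ be a 4-colouring of $H_n$ with $A(a)=1$ such that $|p(A)|\le2$ and no vertex of $p(A)$ forms a single Kempe chain. Then there is a 4-colouring $B$ of $H_n$ with $d(B)=|p(B)|\le 2$ such that $B$ is equivalent to $A$ up to $3|p(A)|$ Kempe changes.
   Context: Fix $n\ge5$. $G_n$ is a simple plane triangulation having two non-adjacent vertices $a,b$ of degree $n$ (the poles) and $2n$ vertices of degree $5$; $N_a,N_b$ are the cycles induced by the neighbours of $a$ and $b$; $H_n=G_n-b$. An edge is of type 1 if one end lies on $N_a$ and the other on $N_b$. 4-colourings of $H_n$ are maps $V(H_n)\to\{1,2,3,4\}$ giving adjacent vertices different colours, normalized so that $A(a)=1$. $A(i,j)$ is the subgraph of $H_n$ induced by vertices coloured $i$ or $j$; its components are Kempe chains; a Kempe change swaps $i,j$ on one chain, and it is proper if that chain is not the whole of $A(i,j)$. A vertex $v$ forms a single Kempe chain if $\{v\}$ is a component of $A(i,j)$ for some pair of distinct colours $i,j$. $d(A)$ is the number of type-1 edges in $A(1,2)$; $p(A)$ is the set of vertices of $N_b$ coloured 1. "$A$ and $B$ are equivalent up to $m$ Kempe changes" means $B$ can be obtained from $A$ by a sequence of Kempe changes at most $m$ of which are proper (equivalently, some colouring obtained from $B$ by permuting colours is obtained from $A$ by at most $m$ Kempe changes). -}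

module Defs where

open import Data.Nat using (ℕ; zero; suc; _+_; _*_; _≤_)
open import Data.Fin using (Fin; toℕ) renaming (zero to fzero; suc to fsuc)
open import Data.Fin.Properties using () renaming (_≟_ to _≟ᶠ_)
open import Data.List using (List; length; filter; cartesianProduct)
open import Data.Product using (Σ; ∃; _×_; _,_; proj₁; proj₂)
open import Data.Sum using (_⊎_)
open import Data.Bool using (if_then_else_)
open import Relation.Nullary using (¬_; does; Dec)
open import Relation.Nullary.Decidable using (_×-dec_; _⊎-dec_)
open import Data.Nat using (_≟_)
open import Relation.Binary.PropositionalEquality using (_≡_; _≢_)
open import Data.List using (allFin) public

-- The graph G_n (concrete model) and H_n = G_n - b.
-- Vertices of H_n: the pole a, the cycle N_a = x_0 … x_{n-1},
-- the cycle N_b = y_0 … y_{n-1} (indices mod n).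

data V (n : ℕ) : Set where
  pa : V n
  x  : Fin n → V n
  y  : Fin n → V n

CSucc : {n : ℕ} → Fin n → Fin n → Set
CSucc {n} i j = (toℕ j ≡ suc (toℕ i)) ⊎ ((suc (toℕ i) ≡ n) × (toℕ j ≡ 0))

-- one orientation of each edge of H_n
data E {n : ℕ} : V n → V n → Set where
  ax    : (i : Fin n) → E pa (x i)
  xx    : (i j : Fin n) → CSucc i j → E (x i) (x j)
  yy    : (i j : Fin n) → CSucc i j → E (y i) (y j)
  xy₀   : (i : Fin n) → E (x i) (y i)
  xy₁   : (i j : Fin n) → CSucc i j → E (x i) (y j)

Adj : {n : ℕ} → V n → V n → Set
Adj u v = E u v ⊎ E v u

data Type1 {n : ℕ} : V n → V n → Set where
  t₀ : (i : Fin n) → Type1 (x i) (y i)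
  t₁ : (i j : Fin n) → CSucc i j → Type1 (x i) (y j)

-- Colourings. Colours {1,2,3,4} are Fin 4; colour 1 is fzero, colour 2 is fsuc fzero.

Colour : Set
Colour = Fin 4

c1 c2 : Colour
c1 = fzero
c2 = fsuc fzero

Col : ℕ → Set
Col n = V n → Colour

Proper : {n : ℕ} → Col n → Set
Proper {n} A = ∀ (u v : V n) → Adj u v → A u ≢ A v

Normalized : {n : ℕ} → Col n → Set
Normalized A = Proper A × (A pa ≡ c1)

InPair : Colour → Colour → Colour → Set
InPair c i j = (c ≡ i) ⊎ (c ≡ j)

-- Chain A i j v w : w lies in the component of v in A(i,j)
data Chain {n : ℕ} (A : Col n) (i j : Colour) (v : V n) : V n → Set where
  here : InPair (A v) i j → Chain A i j v v
  step : ∀ {u w} → Chain A i j v u → Adj u w → InPair (A w) i j → Chain A i j v w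

swap : Colour → Colour → Colour → Colour
swap i j c = if does (c ≟ᶠ i) then j else (if does (c ≟ᶠ j) then i else c)

KempeStep : {n : ℕ} → Col n → Col n → Colour → Colour → V n → Set
KempeStep {n} A B i j v =
  (i ≢ j) × InPair (A v) i j ×
  (∀ (w : V n) → (Chain A i j v w → B w ≡ swap i j (A w))
               × (¬ Chain A i j v w → B w ≡ A w))

ProperChange : {n : ℕ} → Col n → Colour → Colour → V n → Set
ProperChange A i j v = ∃ λ w → InPair (A w) i j × ¬ Chain A i j v w

-- KSeq m A B : B is obtained from A by a sequence of Kempe changes,
-- at most m of which are proper.
data KSeq {n : ℕ} : ℕ → Col n → Col n → Set where
  done     : ∀ {m A B} → (∀ w → A w ≡ B w) → KSeq m A B
  properK  : ∀ {m A C B i j v} → KempeStep A C i j v → ProperChange A i j v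
           → KSeq m C B → KSeq (suc m) A B
  improper : ∀ {m A C B i j v} → KempeStep A C i j v → ¬ ProperChange A i j v
           → KSeq m C B → KSeq m A B

SingleChain : {n : ℕ} → Col n → V n → Set
SingleChain A v = Σ Colour λ i → Σ Colour λ j →
  (i ≢ j) × InPair (A v) i j × (∀ w → Chain A i j v w → w ≡ v)

pSize : {n : ℕ} → Col n → ℕ
pSize {n} A = length (filter (λ i → A (y i) ≟ᶠ c1) (allFin n))

inPair? : (c i j : Colour) → Dec (InPair c i j)
inPair? c i j = (c ≟ᶠ i) ⊎-dec (c ≟ᶠ j)

csucc? : {n : ℕ} → (i j : Fin n) → Dec (CSucc i j)
csucc? {n} i j = (toℕ j ≟ suc (toℕ i)) ⊎-dec ((suc (toℕ i) ≟ n) ×-dec (toℕ j ≟ 0))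

d₀ : {n : ℕ} → Col n → ℕ
d₀ {n} A = length (filter (λ i → inPair? (A (x i)) c1 c2 ×-dec inPair? (A (y i)) c1 c2) (allFin n))

d₁ : {n : ℕ} → Col n → ℕ
d₁ {n} A = length (filter (λ p → csucc? (proj₁ p) (proj₂ p)
                                 ×-dec inPair? (A (x (proj₁ p))) c1 c2
                                 ×-dec inPair? (A (y (proj₂ p))) c1 c2)
                          (cartesianProduct (allFin n) (allFin n)))

d : {n : ℕ} → Col n → ℕ
d A = d₀ A + d₁ A

-- A vertex y_k of p(A) has exactly two neighbours on N_a, x_k and x_(k-1); they are adjacent and
-- never coloured 1. Call y_k covered if one of them is coloured 2: it then contributes exactly one
-- type-1 edge to A(1,2), so d = |p| once all of p is covered. If y_j is not covered, x_j and
-- x_(j-1) carry the colours 3 and 4, and the (2,c)-Kempe change at the one coloured c covers y_j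
-- without touching colour 1, so p is unchanged. That change can only uncover a y_k whose
-- N_a-neighbours are coloured 2 and the colour other than c, and with |p| ≤ 2 this cannot happen
-- for both c = 3 and c = 4. At most two vertices of p need such a repair, so at most two Kempe
-- changes are made, and 2 ≤ 3|p(A)| as soon as one is needed.
module Submission where

open import Defs

open import Data.Empty using (⊥; ⊥-elim)
open import Data.Fin using (Fin; zero; suc; fromℕ; inject₁; punchIn)
open import Data.Fin.Properties
  using (any?; all?; pigeonhole; <⇒≢; punchInᵢ≢i; toℕ-fromℕ; toℕ-inject₁; toℕ-injective)
  renaming (_≟_ to _≟ᶠ_)
open import Data.Fin.Subset using (Subset; ⁅_⁆; _∪_; _⊂_; _⊃_) renaming (_∈_ to _∈ˢ_)
open import Data.Fin.Subset.Induction using (Acc; acc; ⊃-wellFounded)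
open import Data.Fin.Subset.Properties using (_∈?_; p⊆p∪q; x∈p∪q⁺; x∈p∪q⁻; x∈⁅x⁆; x∈⁅y⁆⇒x≡y)
open import Data.List using (List; _∷_; _++_; map; length; filter; tabulate; lookup; cartesianProduct)
open import Data.List.Membership.Propositional using (_∈_; lose)
open import Data.List.Membership.Propositional.Properties
  using (∈-filter⁺; ∈-allFin; ∈-map⁺; ∈-++⁺ˡ; ∈-++⁺ʳ)
open import Data.List.Membership.Setoid.Properties using (index-injective)
open import Data.List.Properties using (filter-++; length-++; map-tabulate; filter-some; filter-≐)
open import Data.List.Relation.Unary.Any using (here; there; index)
open import Data.List.Relation.Unary.Any.Properties using (lookup-index)
open import Data.List.Relation.Unary.Enumerates.Setoid using (IsEnumeration)
open import Data.Nat using (ℕ; zero; suc; _+_; _*_; _≤_; _≤?_; z≤n; s≤s)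
open import Data.Nat.Properties
  using (+-0-commutativeMonoid; +-identityʳ; suc-injective; ≤-trans; ≰⇒>; ≤⇒≯; n≤1+n; *-monoʳ-≤)
open import Algebra.Properties.CommutativeMonoid.Sum +-0-commutativeMonoid
  using (sum; sum-syntax; sum-cong-≗; sum-remove; sum-replicate-zero; ∑-distrib-+; ∑-comm)
open import Data.Product using (Σ; ∃; _×_; _,_; proj₁; proj₂)
open import Data.Sum using (_⊎_; inj₁; inj₂; [_,_]′)
open import Function using (_∘_; id; case_of_; _⇔_; mk⇔; Equivalence)
open import Function.Definitions using (Injective)
open import Relation.Binary.Construct.Closure.ReflexiveTransitive using (Star; ε; _◅_; _◅◅_; gmap)
open import Relation.Binary.PropositionalEquality
  using (_≡_; _≢_; refl; sym; trans; cong; cong₂; subst; subst₂; setoid; module ≡-Reasoning)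
open import Relation.Nullary using (¬_; Dec; yes; no; contradiction)
open import Relation.Nullary.Decidable
  using (map′; ¬?; _×-dec_; _⊎-dec_; _→-dec_; toWitness; decidable-stable)
open import Relation.Unary using (Decidable)

private
  variable
    n : ℕ
    X : Set

indicator : {P : Set} → Dec P → ℕ
indicator (yes _) = 1
indicator (no _)  = 0

indicator-¬ : {P : Set} (p : Dec P) → ¬ P → indicator p ≡ 0
indicator-¬ (yes p) ¬p = contradiction p ¬p
indicator-¬ (no _)  _  = refl

indicator-⊎ : {P Q R : Set} (p : Dec P) (q : Dec Q) (r : Dec R) →
              (P → Q → ⊥) → (P ⊎ Q → R) → (R → P ⊎ Q) →
              indicator p + indicator q ≡ indicator r
indicator-⊎ (yes p) (yes q) _       disj _ _ = contradiction q (disj p)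
indicator-⊎ (yes p) (no _)  (yes _) _    _ _ = refl
indicator-⊎ (yes p) (no _)  (no ¬r) _    f _ = contradiction (f (inj₁ p)) ¬r
indicator-⊎ (no _)  (yes q) (yes _) _    _ _ = refl
indicator-⊎ (no _)  (yes q) (no ¬r) _    f _ = contradiction (f (inj₂ q)) ¬r
indicator-⊎ (no ¬p) (no ¬q) (yes r) _    _ g = contradiction (g r) [ ¬p , ¬q ]′
indicator-⊎ (no _)  (no _)  (no _)  _    _ _ = refl

length-filter-tabulate : {P : X → Set} (P? : Decidable P) (f : Fin n → X) →
                         length (filter P? (tabulate f)) ≡ ∑[ i < n ] indicator (P? (f i))
length-filter-tabulate {n = zero}  P? f = refl
length-filter-tabulate {n = suc n} P? f with P? (f zero)
... | yes _ = cong suc (length-filter-tabulate P? (f ∘ suc))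
... | no _  = length-filter-tabulate P? (f ∘ suc)

length-filter-cartesianProduct :
  {X Y : Set} {m n : ℕ} {P : X × Y → Set} (P? : Decidable P) (f : Fin m → X) (g : Fin n → Y) →
  length (filter P? (cartesianProduct (tabulate f) (tabulate g)))
    ≡ ∑[ i < m ] ∑[ j < n ] indicator (P? (f i , g j))
length-filter-cartesianProduct {m = zero}  P? f g = refl
length-filter-cartesianProduct {X = X} {Y} {suc m} {n} P? f g = begin
  length (filter P? (row ++ rest))                  ≡⟨ cong length (filter-++ P? row rest) ⟩
  length (filter P? row ++ filter P? rest)          ≡⟨ length-++ (filter P? row) ⟩
  length (filter P? row) + length (filter P? rest)  ≡⟨ cong₂ _+_ first-row rows ⟩
  ∑[ j < n ] I zero j + ∑[ i < m ] ∑[ j < n ] I (suc i) j ∎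
  where
  open ≡-Reasoning
  I : Fin (suc m) → Fin n → ℕ
  I i j = indicator (P? (f i , g j))
  row rest : List (X × Y)
  row  = map (f zero ,_) (tabulate g)
  rest = cartesianProduct (tabulate (f ∘ suc)) (tabulate g)
  first-row : length (filter P? row) ≡ ∑[ j < n ] I zero j
  first-row = trans (cong (length ∘ filter P?) (map-tabulate g (f zero ,_)))
                    (length-filter-tabulate P? (λ j → f zero , g j))
  rows : length (filter P? rest) ≡ ∑[ i < m ] ∑[ j < n ] I (suc i) j
  rows = length-filter-cartesianProduct P? (f ∘ suc) g

∑-supported-at : (f : Fin n → ℕ) (i : Fin n) → (∀ j → j ≢ i → f j ≡ 0) → ∑[ j < n ] f j ≡ f i
∑-supported-at {suc n} f i vanishes = begin
  sum f                          ≡⟨ sum-remove {i = i} f ⟩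
  f i + sum (f ∘ punchIn i)      ≡⟨ cong (f i +_) (sum-cong-≗ λ j → vanishes (punchIn i j) (punchInᵢ≢i i j)) ⟩
  f i + sum (λ (_ : Fin n) → 0)  ≡⟨ cong (f i +_) (sum-replicate-zero n) ⟩
  f i + 0                        ≡⟨ +-identityʳ (f i) ⟩
  f i                            ∎
  where open ≡-Reasoning

injective-members⇒≤length : {k : ℕ} {xs : List X} (f : Fin k → X) → Injective _≡_ _≡_ f →
                            (∀ i → f i ∈ xs) → k ≤ length xs
injective-members⇒≤length {X = X} {k = k} {xs} f f-inj f∈xs with k ≤? length xs
... | yes k≤ = k≤
... | no k≰ with i , j , i<j , same-index ← pigeonhole (≰⇒> k≰) (index ∘ f∈xs) =
  contradiction (f-inj (index-injective (setoid X) (f∈xs i) (f∈xs j) same-index)) (<⇒≢ i<j)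

-- Reachability in finite graphs

-- The set reachable from s is grown from {s} by one missing R-successor at a time;
-- this terminates because ⊃ is well-founded on subsets of Fin N.
module _ {N : ℕ} {R : Fin N → Fin N → Set} (R? : ∀ i j → Dec (R i j)) (s : Fin N) where

  private
    Sound Closed : Subset N → Set
    Sound  S = ∀ {t} → t ∈ˢ S → Star R s t
    Closed S = ∀ {u w} → u ∈ˢ S → R u w → w ∈ˢ S

    closure : ∀ S → Acc _⊃_ S → s ∈ˢ S → Sound S → ∃ λ T → s ∈ˢ T × Sound T × Closed T
    closure S (acc larger) s∈S sound
      with any? (λ u → any? λ w → (u ∈? S ×-dec R? u w) ×-dec ¬? (w ∈? S))
    ... | yes (u , w , (u∈S , uRw) , w∉S) =
      closure (S ∪ ⁅ w ⁆) (larger S⊂S∪w) (p⊆p∪q ⁅ w ⁆ s∈S) sound∪w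
      where
      S⊂S∪w : S ⊂ S ∪ ⁅ w ⁆
      S⊂S∪w = (λ {t} → p⊆p∪q ⁅ w ⁆) , w , x∈p∪q⁺ (inj₂ (x∈⁅x⁆ w)) , w∉S
      sound∪w : Sound (S ∪ ⁅ w ⁆)
      sound∪w t∈ with x∈p∪q⁻ S ⁅ w ⁆ t∈
      ... | inj₁ t∈S = sound t∈S
      ... | inj₂ t∈w with refl ← x∈⁅y⁆⇒x≡y w t∈w = sound u∈S ◅◅ uRw ◅ ε
    ... | no no-exit = S , s∈S , sound , λ {u} {w} u∈S uRw →
      decidable-stable (w ∈? S) λ w∉S → no-exit (u , w , (u∈S , uRw) , w∉S)

    Closed-Star : ∀ {S u t} → Closed S → u ∈ˢ S → Star R u t → t ∈ˢ S
    Closed-Star closed u∈S ε            = u∈S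
    Closed-Star closed u∈S (uRw ◅ path) = Closed-Star closed (closed u∈S uRw) path

    sound-⁅s⁆ : Sound ⁅ s ⁆
    sound-⁅s⁆ t∈s = subst (Star R s) (sym (x∈⁅y⁆⇒x≡y s t∈s)) ε

  star?-Fin : ∀ t → Dec (Star R s t)
  star?-Fin t
    with T , s∈T , sound , closed ← closure ⁅ s ⁆ (⊃-wellFounded ⁅ s ⁆) (x∈⁅x⁆ s) sound-⁅s⁆ =
    map′ sound (Closed-Star closed s∈T) (t ∈? T)

module Enumerated {xs : List X} (_∈xs : IsEnumeration (setoid X) xs) where

  private
    encode : X → Fin (length xs)
    encode a = index (a ∈xs)

    decode-encode : ∀ a → lookup xs (encode a) ≡ a
    decode-encode a = sym (lookup-index (a ∈xs))

  ∃? : {P : X → Set} → Decidable P → Dec (∃ P)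
  ∃? {P} P? = map′ (λ (i , p) → lookup xs i , p)
                   (λ (a , p) → encode a , subst P (sym (decode-encode a)) p)
                   (any? (P? ∘ lookup xs))

  star? : {R : X → X → Set} → (∀ a b → Dec (R a b)) → ∀ a b → Dec (Star R a b)
  star? {R} R? a b = map′ from to (star?-Fin (λ i j → R? (lookup xs i) (lookup xs j)) (encode a) (encode b))
    where
    to : Star R a b → Star _ (encode a) (encode b)
    to = gmap encode λ {a} {b} r → subst₂ R (sym (decode-encode a)) (sym (decode-encode b)) r
    from : Star _ (encode a) (encode b) → Star R a b
    from path = subst₂ (Star R) (decode-encode a) (decode-encode b) (gmap (lookup xs) id path)

swap-involutive : ∀ i j c → swap i j (swap i j c) ≡ c
swap-involutive = toWitness {a? = all? λ i → all? λ j → all? λ c → swap i j (swap i j c) ≟ᶠ c} _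

swap-injective : ∀ {i j a b} → swap i j a ≡ swap i j b → a ≡ b
swap-injective {i} {j} {a} {b} eq =
  trans (sym (swap-involutive i j a)) (trans (cong (swap i j) eq) (swap-involutive i j b))

swap-InPair : ∀ {i j c} → InPair c i j → InPair (swap i j c) i j
swap-InPair {i} {j} {c} = toWitness {a? = all? λ i → all? λ j → all? λ c →
  inPair? c i j →-dec inPair? (swap i j c) i j} _ i j c

swap-outside : ∀ {i j c} → ¬ InPair c i j → swap i j c ≡ c
swap-outside {i} {j} {c} = toWitness {a? = all? λ i → all? λ j → all? λ c →
  ¬? (inPair? c i j) →-dec (swap i j c ≟ᶠ c)} _ i j c

swap-ji : ∀ i j → swap i j j ≡ i
swap-ji = toWitness {a? = all? λ i → all? λ j → swap i j j ≟ᶠ i} _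

-- apart from 1 and 2 there are only two colours
≢-same⇒≡ : ∀ {a b c} → ¬ InPair a c1 c2 → ¬ InPair b c1 c2 → ¬ InPair c c1 c2 →
           a ≢ b → c ≢ b → a ≡ c
≢-same⇒≡ {a} {b} {c} = toWitness {a? = all? λ a → all? λ b → all? λ c →
  ¬? (inPair? a c1 c2) →-dec (¬? (inPair? b c1 c2) →-dec (¬? (inPair? c c1 c2) →-dec
  (¬? (a ≟ᶠ b) →-dec (¬? (c ≟ᶠ b) →-dec (a ≟ᶠ c)))))} _ a b c

prev : Fin n → Fin n
prev {suc m} zero    = fromℕ m
prev {suc m} (suc i) = inject₁ i

CSucc-prev : (j : Fin n) → CSucc (prev j) j
CSucc-prev {suc m} zero    = inj₂ (cong suc (toℕ-fromℕ m) , refl)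
CSucc-prev {suc m} (suc i) = inj₁ (cong suc (sym (toℕ-inject₁ i)))

CSucc⇒≡prev : {i j : Fin n} → CSucc i j → i ≡ prev j
CSucc⇒≡prev {suc m} {j = zero}  (inj₁ ())
CSucc⇒≡prev {suc m} {j = zero}  (inj₂ (i+1≡n , _)) =
  toℕ-injective (trans (suc-injective i+1≡n) (sym (toℕ-fromℕ m)))
CSucc⇒≡prev {suc m} {j = suc j} (inj₁ j≡i+1) =
  toℕ-injective (trans (suc-injective (sym j≡i+1)) (sym (toℕ-inject₁ j)))
CSucc⇒≡prev {suc m} {j = suc j} (inj₂ (_ , ()))

vertices : (n : ℕ) → List (V n)
vertices n = pa ∷ map x (allFin n) ++ map y (allFin n)

vertices-complete : IsEnumeration (setoid (V n)) (vertices n)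
vertices-complete pa    = here refl
vertices-complete (x i) = there (∈-++⁺ˡ (∈-map⁺ x (∈-allFin i)))
vertices-complete {n} (y i) = there (∈-++⁺ʳ (map x (allFin n)) (∈-map⁺ y (∈-allFin i)))

module Vertices {n : ℕ} = Enumerated (vertices-complete {n})

E? : (u w : V n) → Dec (E u w)
E? pa    (x i) = yes (ax i)
E? (x i) (x j) = map′ (xx i j) (λ { (xx _ _ i~j) → i~j }) (csucc? i j)
E? (y i) (y j) = map′ (yy i j) (λ { (yy _ _ i~j) → i~j }) (csucc? i j)
E? (x i) (y j) with i ≟ᶠ j | csucc? i j
... | yes refl | _        = yes (xy₀ i)
... | no _     | yes i~j  = yes (xy₁ i j i~j)
... | no i≢j   | no ¬i~j  = no λ { (xy₀ _) → i≢j refl ; (xy₁ _ _ i~j) → ¬i~j i~j }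
E? pa    pa    = no λ ()
E? pa    (y _) = no λ ()
E? (x _) pa    = no λ ()
E? (y _) pa    = no λ ()
E? (y _) (x _) = no λ ()

Adj? : (u w : V n) → Dec (Adj u w)
Adj? u w = E? u w ⊎-dec E? w u

Adj-sym : {u w : V n} → Adj u w → Adj w u
Adj-sym (inj₁ e) = inj₂ e
Adj-sym (inj₂ e) = inj₁ e

module _ {A : Col n} (nA : Normalized A) where

  x≢c1 : ∀ k → A (x k) ≢ c1
  x≢c1 k eq = proj₁ nA pa (x k) (inj₁ (ax k)) (trans (proj₂ nA) (sym eq))

  x-prev≢x : ∀ k → A (x (prev k)) ≢ A (x k)
  x-prev≢x k = proj₁ nA _ _ (inj₁ (xx _ k (CSucc-prev k)))

  x-outside-12 : ∀ {k} → A (x k) ≢ c2 → ¬ InPair (A (x k)) c1 c2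
  x-outside-12 {k} ≢2 = [ x≢c1 k , ≢2 ]′

  InPair-x : ∀ {k} → InPair (A (x k)) c1 c2 → A (x k) ≡ c2
  InPair-x {k} (inj₁ eq) = contradiction eq (x≢c1 k)
  InPair-x     (inj₂ eq) = eq

-- Kempe changes

KempeEdge : Col n → Colour → Colour → V n → V n → Set
KempeEdge A i j u w = Adj u w × InPair (A w) i j

module _ {A : Col n} {i j : Colour} {v : V n} where

  Chain-source : ∀ {w} → Chain A i j v w → InPair (A v) i j
  Chain-source (here p)      = p
  Chain-source (step ch _ _) = Chain-source ch

  Chain-target : ∀ {w} → Chain A i j v w → InPair (A w) i j
  Chain-target (here p)     = p
  Chain-target (step _ _ p) = p

  Chain⇒Star : ∀ {w} → Chain A i j v w → Star (KempeEdge A i j) v w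
  Chain⇒Star (here _)        = ε
  Chain⇒Star (step ch u~w p) = Chain⇒Star ch ◅◅ (u~w , p) ◅ ε

  Chain-◅◅ : ∀ {u w} → Chain A i j v u → Star (KempeEdge A i j) u w → Chain A i j v w
  Chain-◅◅ ch ε                  = ch
  Chain-◅◅ ch ((u~w , p) ◅ path) = Chain-◅◅ (step ch u~w p) path

-- opaque, so that with-abstracting over chain? does not unfold the reachability search
opaque
  chain? : (A : Col n) (i j : Colour) (v w : V n) → Dec (Chain A i j v w)
  chain? A i j v w =
    map′ (λ (p , path) → Chain-◅◅ (here p) path) (λ ch → Chain-source ch , Chain⇒Star ch)
         (inPair? (A v) i j ×-dec Vertices.star? (λ u w → Adj? u w ×-dec inPair? (A w) i j) v w)

properChange? : (A : Col n) (i j : Colour) (v : V n) → Dec (ProperChange A i j v)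
properChange? A i j v = Vertices.∃? λ w → inPair? (A w) i j ×-dec ¬? (chain? A i j v w)

kempe : Col n → Colour → Colour → V n → Col n
kempe A i j v w with chain? A i j v w
... | yes _ = swap i j (A w)
... | no _  = A w

module _ {A : Col n} {i j : Colour} {v : V n} where

  kempe-in : ∀ {w} → Chain A i j v w → kempe A i j v w ≡ swap i j (A w)
  kempe-in {w} ch with chain? A i j v w
  ... | yes _  = refl
  ... | no ¬ch = contradiction ch ¬ch

  kempe-out : ∀ {w} → ¬ Chain A i j v w → kempe A i j v w ≡ A w
  kempe-out {w} ¬ch with chain? A i j v w
  ... | yes ch = contradiction ch ¬ch
  ... | no _   = refl

  kempe-source : A v ≡ j → kempe A i j v v ≡ i
  kempe-source Av≡j = trans (kempe-in (here (inj₂ Av≡j))) (trans (cong (swap i j) Av≡j) (swap-ji i j))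

  kempe-KempeStep : i ≢ j → InPair (A v) i j → KempeStep A (kempe A i j v) i j v
  kempe-KempeStep i≢j p = i≢j , p , λ w → kempe-in , kempe-out

  kempe-proper : Proper A → Proper (kempe A i j v)
  kempe-proper proper u w u~w eq with chain? A i j v u | chain? A i j v w
  ... | yes cu | yes cw = proper u w u~w (swap-injective eq)
  ... | no _   | no _   = proper u w u~w eq
  ... | yes cu | no ¬cw =
    ¬cw (step cu u~w (subst (λ c → InPair c i j) eq (swap-InPair (Chain-target cu))))
  ... | no ¬cu | yes cw =
    ¬cu (step cw (Adj-sym u~w) (subst (λ c → InPair c i j) (sym eq) (swap-InPair (Chain-target cw))))

  kempe-≡-outside : ∀ {c w} → ¬ InPair c i j → kempe A i j v w ≡ c ⇔ A w ≡ c
  kempe-≡-outside {c} {w} c∉ij with chain? A i j v w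
  ... | yes _ = mk⇔ (λ eq → swap-injective (trans eq (sym (swap-outside c∉ij))))
                    (λ eq → trans (cong (swap i j) eq) (swap-outside c∉ij))
  ... | no _  = mk⇔ id id

  -- an i–j edge lies in a single Kempe chain, so the change keeps one of its ends coloured i
  kempe-edge : ∀ {a b} → Adj a b → A a ≡ i → A b ≡ j → kempe A i j v a ≡ i ⊎ kempe A i j v b ≡ i
  kempe-edge {a} {b} a~b Aa≡i Ab≡j with chain? A i j v a | chain? A i j v b
  ... | _      | yes _ = inj₂ (trans (cong (swap i j) Ab≡j) (swap-ji i j))
  ... | no _   | no _  = inj₁ Aa≡i
  ... | yes ca | no ¬cb = contradiction (step ca a~b (inj₂ Ab≡j)) ¬cb

KSeq-weaken : ∀ {m m′} {A B : Col n} → m ≤ m′ → KSeq m A B → KSeq m′ A B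
KSeq-weaken _          (done eq)          = done eq
KSeq-weaken (s≤s m≤m′) (properK s p rest)  = properK s p (KSeq-weaken m≤m′ rest)
KSeq-weaken m≤m′       (improper s p rest) = improper s p (KSeq-weaken m≤m′ rest)

kempe-cons : ∀ {m} {A B : Col n} {i j v} → i ≢ j → InPair (A v) i j →
             KSeq m (kempe A i j v) B → KSeq (suc m) A B
kempe-cons {A = A} {i = i} {j} {v} i≢j p rest with properChange? A i j v
... | yes proper = properK (kempe-KempeStep i≢j p) proper rest
... | no ¬proper = improper (kempe-KempeStep i≢j p) ¬proper (KSeq-weaken (n≤1+n _) rest)

pSize≡∑ : (A : Col n) → pSize A ≡ ∑[ k < n ] indicator (A (y k) ≟ᶠ c1)
pSize≡∑ A = length-filter-tabulate (λ k → A (y k) ≟ᶠ c1) id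

pSize-cong : {A B : Col n} → (∀ k → A (y k) ≡ c1 ⇔ B (y k) ≡ c1) → pSize A ≡ pSize B
pSize-cong {n} {A} {B} same = cong length (filter-≐ (λ k → A (y k) ≟ᶠ c1) (λ k → B (y k) ≟ᶠ c1)
  ((λ {k} → Equivalence.to (same k)) , (λ {k} → Equivalence.from (same k))) (allFin n))

pSize-nonempty : {A : Col n} (k : Fin n) → A (y k) ≡ c1 → 1 ≤ pSize A
pSize-nonempty {A = A} k yk = filter-some (λ k → A (y k) ≟ᶠ c1) (lose (∈-allFin k) yk)

no-three-in-p : {A : Col n} → pSize A ≤ 2 → {a b c : Fin n} →
                A (y a) ≡ c1 → A (y b) ≡ c1 → A (y c) ≡ c1 → a ≢ b → a ≢ c → b ≢ c → ⊥
no-three-in-p {n} {A} pS {a} {b} {c} ya yb yc a≢b a≢c b≢c =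
  ≤⇒≯ pS (injective-members⇒≤length abc abc-injective (λ i → ∈-filter⁺ _ (∈-allFin (abc i)) (abc-in-p i)))
  where
  abc : Fin 3 → Fin n
  abc zero             = a
  abc (suc zero)       = b
  abc (suc (suc zero)) = c
  abc-in-p : ∀ i → A (y (abc i)) ≡ c1
  abc-in-p zero             = ya
  abc-in-p (suc zero)       = yb
  abc-in-p (suc (suc zero)) = yc
  abc-injective : Injective _≡_ _≡_ abc
  abc-injective {zero}             {zero}             _  = refl
  abc-injective {suc zero}         {suc zero}         _  = refl
  abc-injective {suc (suc zero)}   {suc (suc zero)}   _  = refl
  abc-injective {zero}             {suc zero}         eq = contradiction eq a≢b
  abc-injective {zero}             {suc (suc zero)}   eq = contradiction eq a≢c
  abc-injective {suc zero}         {suc (suc zero)}   eq = contradiction eq b≢c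
  abc-injective {suc zero}         {zero}             eq = contradiction (sym eq) a≢b
  abc-injective {suc (suc zero)}   {zero}             eq = contradiction (sym eq) a≢c
  abc-injective {suc (suc zero)}   {suc zero}         eq = contradiction (sym eq) b≢c

-- the neighbours of y k on N_a are x k and x (prev k)
Covered : Col n → Fin n → Set
Covered A k = A (y k) ≡ c1 → A (x k) ≡ c2 ⊎ A (x (prev k)) ≡ c2

covered? : (A : Col n) (k : Fin n) → Dec (Covered A k)
covered? A k = (A (y k) ≟ᶠ c1) →-dec ((A (x k) ≟ᶠ c2) ⊎-dec (A (x (prev k)) ≟ᶠ c2))

uncovered⇒in-p : {A : Col n} {k : Fin n} → ¬ Covered A k → A (y k) ≡ c1
uncovered⇒in-p {A = A} {k} ¬cov =
  decidable-stable (A (y k) ≟ᶠ c1) λ y≢1 → ¬cov λ y≡1 → contradiction y≡1 y≢1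

module _ {A : Col n} (nA : Normalized A) where

  private
    type1₀? : ∀ k → Dec (InPair (A (x k)) c1 c2 × InPair (A (y k)) c1 c2)
    type1₀? k = inPair? (A (x k)) c1 c2 ×-dec inPair? (A (y k)) c1 c2

    type1₁? : ∀ ik → Dec (CSucc (proj₁ ik) (proj₂ ik)
                          × InPair (A (x (proj₁ ik))) c1 c2 × InPair (A (y (proj₂ ik))) c1 c2)
    type1₁? (i , k) = csucc? i k ×-dec inPair? (A (x i)) c1 c2 ×-dec inPair? (A (y k)) c1 c2

    y-in-p : ∀ {u k} → A u ≡ c2 → Adj u (y k) → InPair (A (y k)) c1 c2 → A (y k) ≡ c1
    y-in-p Au≡2 u~y (inj₁ eq) = eq
    y-in-p Au≡2 u~y (inj₂ eq) = contradiction (trans Au≡2 (sym eq)) (proj₁ nA _ _ u~y)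

    -- y k is joined by type-1 edges to x k and x (prev k) only, and at most one of them lies in A(1,2)
    type1-edges-at : ∀ {k} → Covered A k →
                     indicator (type1₀? k) + indicator (type1₁? (prev k , k)) ≡ indicator (A (y k) ≟ᶠ c1)
    type1-edges-at {k} cov = indicator-⊎ (type1₀? k) (type1₁? (prev k , k)) (A (y k) ≟ᶠ c1)
      (λ (xk , _) (_ , xp , _) → x-prev≢x nA k (trans (InPair-x nA xp) (sym (InPair-x nA xk))))
      (λ { (inj₁ (xk , yk)) → y-in-p (InPair-x nA xk) (inj₁ (xy₀ k)) yk
         ; (inj₂ (_ , xp , yk)) → y-in-p (InPair-x nA xp) (inj₁ (xy₁ _ k (CSucc-prev k))) yk })
      (λ y≡1 → case cov y≡1 of λ
         { (inj₁ xk≡2) → inj₁ (inj₂ xk≡2 , inj₁ y≡1)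
         ; (inj₂ xp≡2) → inj₂ (CSucc-prev k , inj₂ xp≡2 , inj₁ y≡1) })

  d≡pSize : (∀ k → Covered A k) → d A ≡ pSize A
  d≡pSize cov = begin
    d₀ A + d₁ A
      ≡⟨ cong₂ _+_ (length-filter-tabulate type1₀? id) (length-filter-cartesianProduct type1₁? id id) ⟩
    ∑[ k < n ] I₀ k + ∑[ i < n ] ∑[ k < n ] I₁ i k
      ≡⟨ cong (∑[ k < n ] I₀ k +_) (∑-comm I₁) ⟩
    ∑[ k < n ] I₀ k + ∑[ k < n ] ∑[ i < n ] I₁ i k
      ≡⟨ cong (∑[ k < n ] I₀ k +_) (sum-cong-≗ λ k → ∑-supported-at (λ i → I₁ i k) (prev k)
           λ i i≢prev → indicator-¬ (type1₁? (i , k)) (i≢prev ∘ CSucc⇒≡prev ∘ proj₁)) ⟩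
    ∑[ k < n ] I₀ k + ∑[ k < n ] I₁ (prev k) k
      ≡⟨ sym (∑-distrib-+ I₀ (λ k → I₁ (prev k) k)) ⟩
    ∑[ k < n ] (I₀ k + I₁ (prev k) k)
      ≡⟨ sum-cong-≗ (λ k → type1-edges-at (cov k)) ⟩
    ∑[ k < n ] indicator (A (y k) ≟ᶠ c1)
      ≡⟨ sym (pSize≡∑ A) ⟩
    pSize A ∎
    where
    open ≡-Reasoning
    I₀ : Fin n → ℕ
    I₀ k = indicator (type1₀? k)
    I₁ : Fin n → Fin n → ℕ
    I₁ i k = indicator (type1₁? (i , k))

-- Repairing uncovered vertices

-- a (2,c)-Kempe change cannot uncover a vertex of p(A) whose x-neighbours are coloured 2 and c
Compatible : Col n → Colour → Set
Compatible A c = ∀ k → A (y k) ≡ c1 →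
  (A (x k) ≡ c2 → A (x (prev k)) ≡ c) × (A (x (prev k)) ≡ c2 → A (x k) ≡ c)

Flanked : Col n → Colour → Fin n → Set
Flanked A c k = A (y k) ≡ c1 × (A (x k) ≡ c2 × A (x (prev k)) ≡ c ⊎ A (x k) ≡ c × A (x (prev k)) ≡ c2)

flanked? : (A : Col n) (c : Colour) (k : Fin n) → Dec (Flanked A c k)
flanked? A c k = (A (y k) ≟ᶠ c1) ×-dec
  ((A (x k) ≟ᶠ c2 ×-dec A (x (prev k)) ≟ᶠ c) ⊎-dec (A (x k) ≟ᶠ c ×-dec A (x (prev k)) ≟ᶠ c2))

Flanked⇒Covered : {A : Col n} {c : Colour} {k : Fin n} → Flanked A c k → Covered A k
Flanked⇒Covered (_ , inj₁ (xk≡2 , _)) _ = inj₁ xk≡2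
Flanked⇒Covered (_ , inj₂ (_ , xp≡2)) _ = inj₂ xp≡2

Flanked-unique : {A : Col n} {c c′ : Colour} {k : Fin n} → c2 ≢ c → c2 ≢ c′ → c ≢ c′ →
                 Flanked A c k → Flanked A c′ k → ⊥
Flanked-unique _   _    c≢c′ (_ , inj₁ (_ , xp≡c)) (_ , inj₁ (_ , xp≡c′)) = c≢c′ (trans (sym xp≡c) xp≡c′)
Flanked-unique _   2≢c′ _    (_ , inj₁ (xk≡2 , _)) (_ , inj₂ (xk≡c′ , _)) = 2≢c′ (trans (sym xk≡2) xk≡c′)
Flanked-unique 2≢c _    _    (_ , inj₂ (xk≡c , _)) (_ , inj₁ (xk≡2 , _))  = 2≢c (trans (sym xk≡2) xk≡c)
Flanked-unique _   _    c≢c′ (_ , inj₂ (xk≡c , _)) (_ , inj₂ (xk≡c′ , _)) = c≢c′ (trans (sym xk≡c) xk≡c′)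

module _ {A : Col n} (nA : Normalized A) where

  compatible⊎flanked : {c c′ : Colour} → ¬ InPair c c1 c2 → ¬ InPair c′ c1 c2 → c ≢ c′ →
                       Compatible A c ⊎ ∃ (Flanked A c′)
  compatible⊎flanked {c} {c′} c∉12 c′∉12 c≢c′ with any? (flanked? A c′)
  ... | yes flanked = inj₂ flanked
  ... | no unflanked = inj₁ λ k y≡1 →
          (λ xk≡2 → other-is-c (λ xp≡c′ → unflanked (k , y≡1 , inj₁ (xk≡2 , xp≡c′)))
                               (λ xp≡2 → x-prev≢x nA k (trans xp≡2 (sym xk≡2))))
        , (λ xp≡2 → other-is-c (λ xk≡c′ → unflanked (k , y≡1 , inj₂ (xk≡c′ , xp≡2)))
                               (λ xk≡2 → x-prev≢x nA k (trans xp≡2 (sym xk≡2))))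
    where
    other-is-c : ∀ {k} → A (x k) ≢ c′ → A (x k) ≢ c2 → A (x k) ≡ c
    other-is-c ≢c′ ≢2 = ≢-same⇒≡ (x-outside-12 nA ≢2) c′∉12 c∉12 ≢c′ c≢c′

kempe-keeps-Covered : {A : Col n} {c : Colour} {v : V n} {k : Fin n} → ¬ InPair c1 c2 c →
                      Compatible A c → Covered A k → Covered (kempe A c2 c v) k
kempe-keeps-Covered {A = A} {v = v} {k} 1∉2c compat cov y′≡1
  with y≡1 ← Equivalence.to (kempe-≡-outside {A = A} {v = v} {w = y k} 1∉2c) y′≡1 | cov y≡1
... | inj₁ xk≡2 =
  kempe-edge {A = A} {v = v} (inj₂ (xx _ k (CSucc-prev k))) xk≡2 (proj₁ (compat k y≡1) xk≡2)
... | inj₂ xp≡2 = [ inj₂ , inj₁ ]′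
  (kempe-edge {A = A} {v = v} (inj₁ (xx _ k (CSucc-prev k))) xp≡2 (proj₂ (compat k y≡1) xp≡2))

c3 c4 : Colour
c3 = suc (suc zero)
c4 = suc (suc (suc zero))

module _ {A : Col n} {j : Fin n} (nA : Normalized A) (unc : ¬ Covered A j) where

  private
    3∉12 : ¬ InPair c3 c1 c2
    3∉12 = [ (λ ()) , (λ ()) ]′
    4∉12 : ¬ InPair c4 c1 c2
    4∉12 = [ (λ ()) , (λ ()) ]′

  -- if neither 3 nor 4 is compatible, j and vertices flanked by {2,3} and by {2,4} are three points of p(A)
  repair-colour : pSize A ≤ 2 → ∃ λ c → ¬ InPair c c1 c2 × Compatible A c
  repair-colour pS with compatible⊎flanked nA 4∉12 3∉12 (λ ())
  ... | inj₁ compatible₄ = c4 , 4∉12 , compatible₄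
  ... | inj₂ (k₃ , flanked₃) with compatible⊎flanked nA 3∉12 4∉12 (λ ())
  ...   | inj₁ compatible₃ = c3 , 3∉12 , compatible₃
  ...   | inj₂ (k₄ , flanked₄) = ⊥-elim (no-three-in-p {A = A} pS
            (uncovered⇒in-p {A = A} unc) (proj₁ flanked₃) (proj₁ flanked₄)
            (λ { refl → unc (Flanked⇒Covered {A = A} flanked₃) })
            (λ { refl → unc (Flanked⇒Covered {A = A} flanked₄) })
            (λ { refl → Flanked-unique {A = A} (λ ()) (λ ()) (λ ()) flanked₃ flanked₄ }))

  repair-vertex : ∀ {c} → ¬ InPair c c1 c2 → ∃ λ u → (u ≡ x j ⊎ u ≡ x (prev j)) × A u ≡ c
  repair-vertex {c} c∉12 with A (x j) ≟ᶠ c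
  ... | yes xj≡c = x j , inj₁ refl , xj≡c
  ... | no xj≢c  = x (prev j) , inj₂ refl ,
        ≢-same⇒≡ (x-outside-12 nA λ xp≡2 → unc λ _ → inj₂ xp≡2)
                 (x-outside-12 nA λ xj≡2 → unc λ _ → inj₁ xj≡2)
                 c∉12 (x-prev≢x nA j) (xj≢c ∘ sym)

record RepairStep (A : Col n) (j : Fin n) : Set where
  field
    colouring     : Col n
    normalized    : Normalized colouring
    same-p        : ∀ k → colouring (y k) ≡ c1 ⇔ A (y k) ≡ c1
    covers        : Covered colouring j
    keeps-covered : ∀ k → Covered A k → Covered colouring k
    prepend       : ∀ {m B} → KSeq m colouring B → KSeq (suc m) A B

RepairStep-pSize : {A : Col n} {j : Fin n} (fix : RepairStep A j) → pSize (RepairStep.colouring fix) ≡ pSize A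
RepairStep-pSize {A = A} fix = pSize-cong {A = RepairStep.colouring fix} {B = A} (RepairStep.same-p fix)

repair : {A : Col n} {j : Fin n} → Normalized A → pSize A ≤ 2 → ¬ Covered A j → RepairStep A j
repair {A = A} {j} nA pS unc with repair-colour nA unc pS
... | c , c∉12 , compatible with repair-vertex nA unc c∉12
... | u , u-at-j , Au≡c = record
  { colouring     = kempe A c2 c u
  ; normalized    = kempe-proper (proj₁ nA) , Equivalence.from keeps-1 (proj₂ nA)
  ; same-p        = λ _ → keeps-1
  ; covers        = λ _ → case u-at-j of λ { (inj₁ refl) → inj₁ (kempe-source Au≡c)
                                           ; (inj₂ refl) → inj₂ (kempe-source Au≡c) }
  ; keeps-covered = λ _ → kempe-keeps-Covered 1∉2c compatible
  ; prepend       = kempe-cons (λ 2≡c → c∉12 (inj₂ (sym 2≡c))) (inj₂ Au≡c)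
  }
  where
  1∉2c : ¬ InPair c1 c2 c
  1∉2c = [ (λ ()) , (λ 1≡c → c∉12 (inj₁ (sym 1≡c))) ]′
  keeps-1 : ∀ {w} → kempe A c2 c u w ≡ c1 ⇔ A w ≡ c1
  keeps-1 = kempe-≡-outside 1∉2c

all-covered⊎uncovered : (A : Col n) → (∀ k → Covered A k) ⊎ ∃ λ j → ¬ Covered A j
all-covered⊎uncovered A with any? (¬? ∘ covered? A)
... | yes uncovered = inj₂ uncovered
... | no none       = inj₁ λ k → decidable-stable (covered? A k) λ unc → none (k , unc)

uncovered-unique : {A : Col n} {j k k′ : Fin n} → pSize A ≤ 2 → A (y j) ≡ c1 → Covered A j →
                   ¬ Covered A k → ¬ Covered A k′ → k ≡ k′
uncovered-unique {A = A} {k = k} {k′} pS yj≡1 cov unc unc′ with k ≟ᶠ k′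
... | yes k≡k′ = k≡k′
... | no k≢k′  = ⊥-elim (no-three-in-p {A = A} pS yj≡1 (uncovered⇒in-p {A = A} unc) (uncovered⇒in-p {A = A} unc′)
                           (λ { refl → unc cov }) (λ { refl → unc′ cov }) k≢k′)

record Repaired (m : ℕ) (A : Col n) : Set where
  field
    colouring  : Col n
    normalized : Normalized colouring
    covered    : ∀ k → Covered colouring k
    same-pSize : pSize colouring ≡ pSize A
    changes    : KSeq m A colouring

repaired-self : {A : Col n} {m : ℕ} → Normalized A → (∀ k → Covered A k) → Repaired m A
repaired-self {A = A} nA cov = record
  { colouring = A ; normalized = nA ; covered = cov ; same-pSize = refl ; changes = done λ _ → refl }

Repaired-weaken : {A : Col n} {m m′ : ℕ} → m ≤ m′ → Repaired m A → Repaired m′ A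
Repaired-weaken m≤m′ r = record
  { colouring = colouring ; normalized = normalized ; covered = covered
  ; same-pSize = same-pSize ; changes = KSeq-weaken m≤m′ changes }
  where open Repaired r

repaired-after : {A : Col n} {j : Fin n} {m : ℕ} (fix : RepairStep A j) →
                 Repaired m (RepairStep.colouring fix) → Repaired (suc m) A
repaired-after fix rest = record
  { colouring  = colouring ; normalized = normalized ; covered = covered
  ; same-pSize = trans same-pSize (RepairStep-pSize fix)
  ; changes    = RepairStep.prepend fix changes
  }
  where open Repaired rest

repaired-once : {A : Col n} {j : Fin n} → Normalized A → pSize A ≤ 2 → A (y j) ≡ c1 → Covered A j → Repaired 1 A
repaired-once {A = A} nA pS yj≡1 cov with all-covered⊎uncovered A
... | inj₁ all-covered = repaired-self nA all-covered
... | inj₂ (k , unc)   = repaired-after fix (repaired-self normalized now-covered)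
  where
  fix : RepairStep A k
  fix = repair nA pS unc
  open RepairStep fix
  now-covered : ∀ k′ → Covered colouring k′
  now-covered k′ with covered? A k′
  ... | yes cov′ = keeps-covered k′ cov′
  ... | no unc′ with refl ← uncovered-unique {A = A} {k = k} {k′} pS yj≡1 cov unc unc′ = covers

repaired : {A : Col n} → Normalized A → pSize A ≤ 2 → Repaired (3 * pSize A) A
repaired {A = A} nA pS with all-covered⊎uncovered A
... | inj₁ all-covered = repaired-self nA all-covered
... | inj₂ (j , unc)   =
  Repaired-weaken two≤3p
    (repaired-after fix (repaired-once normalized pS′ (Equivalence.from (same-p j) yj≡1) covers))
  where
  fix : RepairStep A j
  fix = repair nA pS unc
  open RepairStep fix
  yj≡1 : A (y j) ≡ c1
  yj≡1 = uncovered⇒in-p {A = A} unc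
  pS′ : pSize colouring ≤ 2
  pS′ = subst (_≤ 2) (sym (RepairStep-pSize fix)) pS
  two≤3p : 2 ≤ 3 * pSize A
  two≤3p = ≤-trans (s≤s (s≤s z≤n)) (*-monoʳ-≤ 3 (pSize-nonempty {A = A} j yj≡1))

lemma2p2 : (n : ℕ) → 5 ≤ n → (A : Col n) → Normalized A → pSize A ≤ 2
         → (∀ (i : Fin n) → A (y i) ≡ c1 → ¬ SingleChain A (y i))
         → Σ (Col n) (λ B → Normalized B × (d B ≡ pSize B) × (pSize B ≤ 2)
                             × KSeq (3 * pSize A) A B)
lemma2p2 n _ A nA pS _ =
  colouring , normalized , d≡pSize normalized covered , subst (_≤ 2) (sym same-pSize) pS , changes
  where open Repaired (repaired nA pS)
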